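{- For every action $a\in Act$ and every closed monitor $m\in Mon_F$: (1) if $m$ is $\mathit{no}$-free then $\mathcal{E}_v\vdash\mathit{yes}+a.m=\mathit{yes}$; (2) if $m$ contains occurrences of both $\mathit{yes}$ and $\mathit{no}$, then $\mathcal{E}_v\vdash\mathit{yes}+a.m=\mathit{yes}+a.n$ for some $\mathit{yes}$-free closed monitor $n$; (3) if $m$ is $\mathit{yes}$-free then $\mathcal{E}_v\vdash\mathit{no}+a.m=\mathit{no}$; (4) if $m$ contains occurrences of both $\mathit{yes}$ and $\mathit{no}$, then $\mathcal{E}_v\vdash\mathit{no}+a.m=\mathit{no}+a.n$ for some $\mathit{no}$-free closed monitor $n$.
   Context: Fix a set $Act$ of visible actions and a countably infinite set $Var$ of variables. Monitors $Mon_F$: $m,n ::= v \mid a.m \mid m+n \mid x$ ($a\in Act$, $x\in Var$), verdicts $v ::= \mathit{end}\mid \mathit{yes}\mid \mathit{no}$. A monitor is closed if it contains no variables; it is $v$-free if it contains no occurrence of the verdict $v$. $\mathcal{E}\vdash m=n$: derivability by reflexivity, symmetry, transitivity, substitutivity and congruence for $a.\_$ and $+$. $\mathcal{E}_v$: (A1) $x+y=y+x$; (A2) $x+(y+z)=(x+y)+z$; (A3) $x+x=x$; (A4) $x+\mathit{end}=x$; for each $a\in Act$: $(E_a)$ $a.\mathit{end}=\mathit{end}$; $(Y_a)$ $\mathit{yes}=\mathit{yes}+a.\mathit{yes}$; $(N_a)$ $\mathit{no}=\mathit{no}+a.\mathit{no}$; $(D_a)$ $a.(x+y)=a.x+a.y$.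 -}

module Defs where

open import Data.Nat using (ℕ)
open import Data.Empty using (⊥)
open import Data.Unit using (⊤)
open import Data.Product using (_×_)
open import Data.Sum using (_⊎_)

data Verdict : Set where
  end yes no : Verdict

data Mon (Act : Set) : Set where
  verd : Verdict → Mon Act
  _·_  : Act → Mon Act → Mon Act
  _⊕_  : Mon Act → Mon Act → Mon Act
  var  : ℕ → Mon Act

infixr 7 _·_
infixl 6 _⊕_

module _ {Act : Set} where

  Closed : Mon Act → Set
  Closed (verd _) = ⊤
  Closed (a · m)  = Closed m
  Closed (m ⊕ n)  = Closed m × Closed n
  Closed (var _)  = ⊥

  Occurs : Verdict → Mon Act → Set
  Occurs v (verd w) = v ≡V w
    where
    _≡V_ : Verdict → Verdict → Set
    end ≡V end = ⊤
    yes ≡V yes = ⊤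
    no  ≡V no  = ⊤
    _   ≡V _   = ⊥
  Occurs v (a · m)  = Occurs v m
  Occurs v (m ⊕ n)  = Occurs v m ⊎ Occurs v n
  Occurs v (var _)  = ⊥

  Free : Verdict → Mon Act → Set
  Free v m = Occurs v m → ⊥

  _[_] : Mon Act → (ℕ → Mon Act) → Mon Act
  verd v  [ σ ] = verd v
  (a · m) [ σ ] = a · (m [ σ ])
  (m ⊕ n) [ σ ] = (m [ σ ]) ⊕ (n [ σ ])
  var x   [ σ ] = σ x

  private
    x y z : Mon Act
    x = var 0
    y = var 1
    z = var 2

  data Axiom : Mon Act → Mon Act → Set where
    A1 : Axiom (x ⊕ y) (y ⊕ x)
    A2 : Axiom (x ⊕ (y ⊕ z)) ((x ⊕ y) ⊕ z)
    A3 : Axiom (x ⊕ x) x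
    A4 : Axiom (x ⊕ verd end) x
    Ea : (a : Act) → Axiom (a · verd end) (verd end)
    Ya : (a : Act) → Axiom (verd yes) (verd yes ⊕ a · verd yes)
    Na : (a : Act) → Axiom (verd no) (verd no ⊕ a · verd no)
    Da : (a : Act) → Axiom (a · (x ⊕ y)) (a · x ⊕ a · y)

  infix 4 Ev⊢_≈_
  data Ev⊢_≈_ : Mon Act → Mon Act → Set where
    refl′  : ∀ {m} → Ev⊢ m ≈ m
    sym′   : ∀ {m n} → Ev⊢ m ≈ n → Ev⊢ n ≈ m
    trans′ : ∀ {m n o} → Ev⊢ m ≈ n → Ev⊢ n ≈ o → Ev⊢ m ≈ o
    inst   : ∀ {l r} → Axiom l r → (σ : ℕ → Mon Act) → Ev⊢ l [ σ ] ≈ r [ σ ]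
    cong·  : ∀ (a : Act) {m n} → Ev⊢ m ≈ n → Ev⊢ a · m ≈ a · n
    cong⊕  : ∀ {m m′ n n′} → Ev⊢ m ≈ m′ → Ev⊢ n ≈ n′ → Ev⊢ m ⊕ n ≈ m′ ⊕ n′

-- Both yes and no absorb every prefixed copy of themselves (v = v + a.v), so in
-- the context v + _ one may also place v under each prefix: v + a.m = v + a.(v + m),
-- and since + is idempotent, v + (m + n) = (v + m) + (v + n).  Hence, in the context
-- v + _, every occurrence of v inside m can be replaced by v + v = v + end, i.e.
-- erased; and when m does not contain the opposite verdict, v + m collapses to v.
module Submission where

open import Defs
open import Data.Product using (_×_; Σ; _,_)
open import Data.Nat using (ℕ; zero; suc)
open import Data.Unit using (tt)
open import Data.Empty using (⊥-elim)
open import Data.Sum using (inj₁; inj₂)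
open import Relation.Binary.Bundles using (Setoid)

eraseVerdict : Verdict → Verdict → Verdict
eraseVerdict yes yes = end
eraseVerdict no  no  = end
eraseVerdict _   u   = u

data Opposite : Verdict → Verdict → Set where
  yes-no : Opposite yes no
  no-yes : Opposite no yes

module _ {Act : Set} where

  private
    M : Set
    M = Mon Act

  ≈-setoid : Setoid _ _
  ≈-setoid = record
    { Carrier       = M
    ; _≈_           = Ev⊢_≈_
    ; isEquivalence = record { refl = refl′ ; sym = sym′ ; trans = trans′ }
    }

  open import Relation.Binary.Reasoning.Setoid ≈-setoid

  private
    sub₃ : M → M → M → ℕ → M
    sub₃ p q r zero          = p
    sub₃ p q r (suc zero)    = q
    sub₃ p q r (suc (suc _)) = r

  ⊕-comm : (p q : M) → Ev⊢ p ⊕ q ≈ q ⊕ p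
  ⊕-comm p q = inst A1 (sub₃ p q p)

  ⊕-assoc : (p q r : M) → Ev⊢ p ⊕ (q ⊕ r) ≈ (p ⊕ q) ⊕ r
  ⊕-assoc p q r = inst A2 (sub₃ p q r)

  ⊕-idem : (p : M) → Ev⊢ p ⊕ p ≈ p
  ⊕-idem p = inst A3 (sub₃ p p p)

  ⊕-identityʳ : (p : M) → Ev⊢ p ⊕ verd end ≈ p
  ⊕-identityʳ p = inst A4 (sub₃ p p p)

  ·-distrib-⊕ : (b : Act) (p q : M) → Ev⊢ b · (p ⊕ q) ≈ b · p ⊕ b · q
  ·-distrib-⊕ b p q = inst (Da b) (sub₃ p q p)

  ⊕-distribˡ-⊕ : (p q r : M) → Ev⊢ p ⊕ (q ⊕ r) ≈ (p ⊕ q) ⊕ (p ⊕ r)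
  ⊕-distribˡ-⊕ p q r = begin
    p ⊕ (q ⊕ r)          ≈⟨ cong⊕ (⊕-idem p) refl′ ⟨
    (p ⊕ p) ⊕ (q ⊕ r)    ≈⟨ ⊕-assoc p p (q ⊕ r) ⟨
    p ⊕ (p ⊕ (q ⊕ r))    ≈⟨ cong⊕ refl′ (⊕-assoc p q r) ⟩
    p ⊕ ((p ⊕ q) ⊕ r)    ≈⟨ cong⊕ refl′ (cong⊕ (⊕-comm p q) refl′) ⟩
    p ⊕ ((q ⊕ p) ⊕ r)    ≈⟨ cong⊕ refl′ (⊕-assoc q p r) ⟨
    p ⊕ (q ⊕ (p ⊕ r))    ≈⟨ ⊕-assoc p q (p ⊕ r) ⟩
    (p ⊕ q) ⊕ (p ⊕ r)    ∎

  absorbs-· : ∀ {v w} → Opposite v w → (b : Act) → Ev⊢ verd v ≈ verd v ⊕ b · verd {Act} v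
  absorbs-· yes-no b = inst (Ya b) (sub₃ (verd end) (verd end) (verd end))
  absorbs-· no-yes b = inst (Na b) (sub₃ (verd end) (verd end) (verd end))

  ⊕-absorb-verdict : ∀ {v w} → Opposite v w → (u : Verdict) → Free w (verd {Act} u) →
                     Ev⊢ verd v ⊕ verd {Act} u ≈ verd v
  ⊕-absorb-verdict {v} _ end _          = ⊕-identityʳ (verd v)
  ⊕-absorb-verdict yes-no yes _         = ⊕-idem (verd yes)
  ⊕-absorb-verdict no-yes no  _         = ⊕-idem (verd no)
  ⊕-absorb-verdict yes-no no  no-free   = ⊥-elim (no-free tt)
  ⊕-absorb-verdict no-yes yes yes-free  = ⊥-elim (yes-free tt)

  erase : Verdict → M → M
  erase v (verd u) = verd (eraseVerdict v u)
  erase v (b · m)  = b · erase v m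
  erase v (m ⊕ n)  = erase v m ⊕ erase v n
  erase v (var x)  = var x

  erase-closed : (v : Verdict) (m : M) → Closed m → Closed (erase v m)
  erase-closed v (verd u) c         = tt
  erase-closed v (b · m)  c         = erase-closed v m c
  erase-closed v (m ⊕ n)  (cm , cn) = erase-closed v m cm , erase-closed v n cn

  ⊕-erase-verdict : (v u : Verdict) → Ev⊢ verd v ⊕ verd u ≈ verd v ⊕ verd {Act} (eraseVerdict v u)
  ⊕-erase-verdict yes yes = trans′ (⊕-idem (verd yes)) (sym′ (⊕-identityʳ (verd yes)))
  ⊕-erase-verdict no  no  = trans′ (⊕-idem (verd no)) (sym′ (⊕-identityʳ (verd no)))
  ⊕-erase-verdict end _   = refl′
  ⊕-erase-verdict yes end = refl′
  ⊕-erase-verdict yes no  = refl′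
  ⊕-erase-verdict no  end = refl′
  ⊕-erase-verdict no  yes = refl′

  erase-free : ∀ {v w} → Opposite v w → (m : M) → Free v (erase v m)
  erase-free yes-no (verd end) ()
  erase-free yes-no (verd yes) ()
  erase-free yes-no (verd no)  ()
  erase-free no-yes (verd end) ()
  erase-free no-yes (verd yes) ()
  erase-free no-yes (verd no)  ()
  erase-free opp (b · m) o        = erase-free opp m o
  erase-free opp (m ⊕ n) (inj₁ o) = erase-free opp m o
  erase-free opp (m ⊕ n) (inj₂ o) = erase-free opp n o
  erase-free opp (var x) ()

  module _ {v w : Verdict} (opp : Opposite v w) where

    ⊕-absorb-· : (b : Act) (m : M) → Ev⊢ verd v ⊕ b · m ≈ verd v ⊕ b · (verd v ⊕ m)
    ⊕-absorb-· b m = begin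
      verd v ⊕ b · m                    ≈⟨ cong⊕ (absorbs-· opp b) refl′ ⟩
      (verd v ⊕ b · verd v) ⊕ b · m     ≈⟨ ⊕-assoc (verd v) (b · verd v) (b · m) ⟨
      verd v ⊕ (b · verd v ⊕ b · m)     ≈⟨ cong⊕ refl′ (·-distrib-⊕ b (verd v) m) ⟨
      verd v ⊕ b · (verd v ⊕ m)         ∎

    ⊕-absorb : (m : M) → Closed m → Free w m → Ev⊢ verd v ⊕ m ≈ verd v
    ⊕-absorb (verd u) _ w-free = ⊕-absorb-verdict opp u w-free
    ⊕-absorb (b · m) c w-free = begin
      verd v ⊕ b · m                ≈⟨ ⊕-absorb-· b m ⟩
      verd v ⊕ b · (verd v ⊕ m)     ≈⟨ cong⊕ refl′ (cong· b (⊕-absorb m c w-free)) ⟩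
      verd v ⊕ b · verd v           ≈⟨ absorbs-· opp b ⟨
      verd v                        ∎
    ⊕-absorb (m ⊕ n) (cm , cn) w-free = begin
      verd v ⊕ (m ⊕ n)              ≈⟨ ⊕-distribˡ-⊕ (verd v) m n ⟩
      (verd v ⊕ m) ⊕ (verd v ⊕ n)
        ≈⟨ cong⊕ (⊕-absorb m cm (λ o → w-free (inj₁ o))) (⊕-absorb n cn (λ o → w-free (inj₂ o))) ⟩
      verd v ⊕ verd v               ≈⟨ ⊕-idem (verd v) ⟩
      verd v                        ∎

    ⊕-erase : (m : M) → Closed m → Ev⊢ verd v ⊕ m ≈ verd v ⊕ erase v m
    ⊕-erase (verd u) _ = ⊕-erase-verdict v u
    ⊕-erase (b · m) c = begin
      verd v ⊕ b · m                        ≈⟨ ⊕-absorb-· b m ⟩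
      verd v ⊕ b · (verd v ⊕ m)             ≈⟨ cong⊕ refl′ (cong· b (⊕-erase m c)) ⟩
      verd v ⊕ b · (verd v ⊕ erase v m)     ≈⟨ ⊕-absorb-· b (erase v m) ⟨
      verd v ⊕ b · erase v m                ∎
    ⊕-erase (m ⊕ n) (cm , cn) = begin
      verd v ⊕ (m ⊕ n)                              ≈⟨ ⊕-distribˡ-⊕ (verd v) m n ⟩
      (verd v ⊕ m) ⊕ (verd v ⊕ n)                   ≈⟨ cong⊕ (⊕-erase m cm) (⊕-erase n cn) ⟩
      (verd v ⊕ erase v m) ⊕ (verd v ⊕ erase v n)   ≈⟨ ⊕-distribˡ-⊕ (verd v) (erase v m) (erase v n) ⟨
      verd v ⊕ (erase v m ⊕ erase v n)              ∎

lemma6 : {Act : Set} (a : Act) (m : Mon Act) → Closed m →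
    (Free no m → Ev⊢ verd yes ⊕ a · m ≈ verd yes)
    × (Occurs yes m × Occurs no m →
        Σ (Mon Act) (λ n → Closed n × Free yes n × (Ev⊢ verd yes ⊕ a · m ≈ verd yes ⊕ a · n)))
    × (Free yes m → Ev⊢ verd no ⊕ a · m ≈ verd no)
    × (Occurs yes m × Occurs no m →
        Σ (Mon Act) (λ n → Closed n × Free no n × (Ev⊢ verd no ⊕ a · m ≈ verd no ⊕ a · n)))
lemma6 a m c =
    ⊕-absorb yes-no (a · m) c
  , (λ _ → erase yes m , erase-closed yes m c , erase-free yes-no m , ⊕-erase yes-no (a · m) c)
  , ⊕-absorb no-yes (a · m) c
  , (λ _ → erase no m , erase-closed no m c , erase-free no-yes m , ⊕-erase no-yes (a · m) c)
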